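{- Let $k\ge 3$ and let $0 \le u \le 2^{k-1}-b_k$ be an integer. Then $$\ell c(B_{b_k+u})=\ell c(B_{a_{k-1}+u}) \quad\text{and}\quad \ell c(B_{2^{k}-(b_k+u)})=\ell c(B_{a_{k-1}+u}).$$
   Context: The Stern polynomials $B_n(t)\in\mathbb{Z}[t]$ are defined by $B_0=0$, $B_1=1$, $B_{2n}=tB_n$, $B_{2n+1}=B_n+B_{n+1}$; $\ell c$ denotes the leading coefficient. A BSD representation of an integer is a digit string $(b_{m-1}\cdots b_0)$ with $b_j\in\{1,0,-1\}$ representing $\sum b_j2^j$. A non-adjacent form (NAF) is a BSD representation in which no two adjacent digits are both nonzero; it is reduced if its leading digit is nonzero. Every positive integer has exactly one reduced NAF; its length is the NAF-bitlength. $I_k$ denotes the set of positive integers of NAF-bitlength $k$ (a set of consecutive integers, e.g. $I_1=\{1\},I_2=\{2\},I_3=\{3,4,5\}$), and for $k\ge3$, $\lvert I_k\rvert=2\lvert I_{k-2}\rvert+\lvert I_{k-1}\rvert$. Write $a_k=\min I_k$ for $k\ge1$ and $a_0=0$ (equivalently $a_1=1,a_2=2$, $a_k=2^{k-2}+a_{k-2}$). For $k\ge3$, $b_k=a_k+\lvert I_{k-2}\rvert$ is the minimum of the middle subinterval $\mathcal{B}_k$ of $I_k$, consisting of the $\lvert I_{k-1}\rvert$ elements of $I_k$ that follow its first $\lvert I_{k-2}\rvert$ elements. -}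

module Defs where

open import Data.Nat using (ℕ; zero; suc; _+_; _*_; _^_)
open import Data.Nat.DivMod using (_/_; _%_)
open import Data.Integer using (ℤ; +_)
open import Data.List using (List; []; _∷_)

-- Polynomials in ℤ[t] as little-endian coefficient lists (index i = coefficient of t^i).
Poly : Set
Poly = List ℤ

_⊕_ : Poly → Poly → Poly
[] ⊕ q = q
(x ∷ p) ⊕ [] = x ∷ p
(x ∷ p) ⊕ (y ∷ q) = (x Data.Integer.+ y) ∷ (p ⊕ q)

mulT : Poly → Poly
mulT p = + 0 ∷ p

-- leading coefficient: last nonzero coefficient (0 for the zero polynomial)
lc : Poly → ℤ
lc [] = + 0
lc (x ∷ p) with lc p
... | + 0 = x
... | c = c

-- Stern polynomials with an explicit fuel argument (fuel > n suffices, since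
-- the recursion n ↦ n/2, n/2+1 strictly decreases for n ≥ 2).
sternF : ℕ → ℕ → Poly
sternF zero _ = []
sternF (suc f) zero = []
sternF (suc f) (suc zero) = + 1 ∷ []
sternF (suc f) n@(suc (suc _)) with n % 2
... | zero = mulT (sternF f (n / 2))
... | suc _ = sternF f (n / 2) ⊕ sternF f (suc (n / 2))

B : ℕ → Poly
B n = sternF (suc n) n

a : ℕ → ℕ
a zero = 0
a (suc zero) = 1
a (suc (suc zero)) = 2
a (suc (suc (suc k))) = 2 ^ (suc k) + a (suc k)

-- |I_k|: |I_1| = 1, |I_2| = 1, |I_k| = 2|I_{k-2}| + |I_{k-1}| (k ≥ 3); |I_0| := 0 (unused)
cardI : ℕ → ℕ
cardI zero = 0
cardI (suc zero) = 1
cardI (suc (suc zero)) = 1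
cardI (suc (suc (suc k))) = 2 * cardI (suc k) + cardI (suc (suc k))

-- b_k = a_k + |I_{k-2}|  (meaningful for k ≥ 3)
b : ℕ → ℕ
b k = a k + cardI (k Data.Nat.∸ 2)

{-# OPTIONS --safe #-}
-- Track the degree and leading coefficient of B_n together as its shape (length, lc).
-- For n ≥ 1 the top coefficient of B_n is positive, so B_{2n} = t B_n raises the shape,
-- and B_{2n+1} = B_n + B_{n+1} takes the shape of the summand of larger degree, adding
-- the leading coefficients on a tie. Halving m then gives, by induction on j ≥ 1,
--   shape B_{2^j + m}     = raise (shape B_m)   for a_j ≤ m ≤ 2^j,
--   shape B_{2^{j+1} + r} = raise (shape B_m)   for r + m = 2^j and a_{j+1} ≤ m.
-- In the step j → j + 1 the halves of m stay in range unless m = 2a − 1 is the term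
-- after a = a_j (resp. a = a_{j+1}), which happens for every other j. There one uses that
-- the degree strictly increases from B_{a − 1} to B_a and from B_{2^j + a_j − 1} to
-- B_{2^j + a_j} (resp. strictly decreases right after 3·2^j − a_{j+1}); such jumps
-- propagate along n ↦ 4n + 1 (resp. n ↦ 4n + 2), which is how these indices grow.
-- As b_k = 2^{k−2} + a_{k−1}, the theorem is the case j = k − 2, m = a_{k−1} + u.
module Submission where

open import Defs
open import Data.Nat using (ℕ; zero; suc; _+_; _*_; _∸_; _^_; _≤_; _<_; _⊔_; z≤n; s≤s; _≤?_)
open import Data.Nat.Properties
open import Data.Nat.DivMod using (_/_; _%_; m*n%n≡0; m*n/n≡m; [m+kn]%n≡m%n; +-distrib-/)
open import Data.Nat.Tactic.RingSolver using (solve-∀)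
open import Data.Integer as ℤ using (ℤ)
import Data.Integer.Properties as ℤ
open import Data.List using ([]; _∷_; length)
open import Data.Product using (_×_; _,_; proj₁; proj₂; ∃-syntax)
open import Data.Sum using (_⊎_; inj₁; inj₂)
open import Function using (_∘_)
open import Relation.Nullary using (yes; no; contradiction)
open import Relation.Binary.PropositionalEquality

2*[1+n]≡2+2*n : ∀ n → 2 * suc n ≡ suc (suc (2 * n))
2*[1+n]≡2+2*n = solve-∀

2*m+[1+2*n]≡1+2*[m+n] : ∀ m n → 2 * m + suc (2 * n) ≡ suc (2 * (m + n))
2*m+[1+2*n]≡1+2*[m+n] = solve-∀

odd+odd≡2*⇒ : ∀ {m n k} → suc (2 * m) + suc (2 * n) ≡ 2 * k → m + suc n ≡ k
odd+odd≡2*⇒ {m} {n} {k} eq = *-cancelˡ-≡ (m + suc n) k 2 (trans (sym (regroup m n)) eq)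
  where
  regroup : ∀ m n → suc (2 * m) + suc (2 * n) ≡ 2 * (m + suc n)
  regroup = solve-∀

2*[2*[1+n]]≡4+2*[2*n] : ∀ n → 2 * (2 * suc n) ≡ suc (suc (suc (suc (2 * (2 * n)))))
2*[2*[1+n]]≡4+2*[2*n] = solve-∀

n<2*n : ∀ {n} → 1 ≤ n → n < 2 * n
n<2*n {n} 1≤n = m<m+n n (≤-trans 1≤n (m≤m+n n 0))

data Parity : ℕ → Set where
  even : ∀ k → Parity (2 * k)
  odd  : ∀ k → Parity (suc (2 * k))

parity : ∀ n → Parity n
parity zero = even 0
parity (suc n) with parity n
... | even k = odd k
... | odd k = subst Parity (2*[1+n]≡2+2*n k) (even (suc k))

half-≤ : ∀ {x y} → 2 * x ≤ suc (2 * y) → x ≤ y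
half-≤ {x} {y} 2x≤1+2y = ≤-pred (*-cancelˡ-< 2 x (suc y) (begin-strict
  2 * x          ≤⟨ 2x≤1+2y ⟩
  suc (2 * y)    <⟨ n<1+n _ ⟩
  suc (suc (2 * y)) ≡⟨ 2*[1+n]≡2+2*n y ⟨
  2 * suc y      ∎))
  where open ≤-Reasoning

2*n%2≡0 : ∀ n → (2 * n) % 2 ≡ 0
2*n%2≡0 n = trans (cong (_% 2) (*-comm 2 n)) (m*n%n≡0 n 2)

1+2*n%2≡1 : ∀ n → suc (2 * n) % 2 ≡ 1
1+2*n%2≡1 n = trans (cong (λ x → suc x % 2) (*-comm 2 n)) ([m+kn]%n≡m%n 1 n 2)

2*n/2≡n : ∀ n → (2 * n) / 2 ≡ n
2*n/2≡n n = trans (cong (_/ 2) (*-comm 2 n)) (m*n/n≡m n 2)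

1+2*n/2≡n : ∀ n → suc (2 * n) / 2 ≡ n
1+2*n/2≡n n = begin
  suc (2 * n) / 2  ≡⟨ cong (λ x → suc x / 2) (*-comm 2 n) ⟩
  (1 + n * 2) / 2  ≡⟨ +-distrib-/ 1 (n * 2) (s≤s (s≤s (≤-reflexive (m*n%n≡0 n 2)))) ⟩
  (n * 2) / 2      ≡⟨ m*n/n≡m n 2 ⟩
  n                ∎
  where open ≡-Reasoning

data PosLead : Poly → Set where
  lead : ∀ n → PosLead (ℤ.+ suc n ∷ [])
  _∷_  : ∀ x {p} → PosLead p → PosLead (x ∷ p)

PosLead⇒0<length : ∀ {p} → PosLead p → 0 < length p
PosLead⇒0<length (lead _) = s≤s z≤n
PosLead⇒0<length (_ ∷ _)  = s≤s z≤n

lc-PosLead : ∀ {p} → PosLead p → ∃[ n ] lc p ≡ ℤ.+ suc n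
lc-∷ : ∀ x {p} → PosLead p → lc (x ∷ p) ≡ lc p

lc-PosLead (lead n) = n , refl
lc-PosLead (x ∷ pl) with lc-PosLead pl
... | n , lc≡ = n , trans (lc-∷ x pl) lc≡

lc-∷ x {p} pl with lc p | lc-PosLead pl
... | .(ℤ.+ suc n) | n , refl = refl

lc-mulT : ∀ p → lc (mulT p) ≡ lc p
lc-mulT p with lc p
... | ℤ.+ zero    = refl
... | ℤ.+ suc _   = refl
... | ℤ.-[1+ _ ] = refl

⊕-identityʳ : ∀ p → p ⊕ [] ≡ p
⊕-identityʳ []      = refl
⊕-identityʳ (_ ∷ _) = refl

length-⊕ : ∀ p q → length (p ⊕ q) ≡ length p ⊔ length q
length-⊕ []      _       = refl
length-⊕ (_ ∷ _) []      = refl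
length-⊕ (_ ∷ p) (_ ∷ q) = cong suc (length-⊕ p q)

Shape : Set
Shape = ℕ × ℤ

shape : Poly → Shape
shape p = length p , lc p

raise : Shape → Shape
raise (l , c) = suc l , c

infixl 6 _⊞_
_⊞_ : Shape → Shape → Shape
(zero  , c) ⊞ (zero  , d) = zero , c ℤ.+ d
(zero  , _) ⊞ (suc n , d) = suc n , d
(suc m , c) ⊞ (zero  , _) = suc m , c
(suc m , c) ⊞ (suc n , d) = raise ((m , c) ⊞ (n , d))

⊞-comm : ∀ x y → x ⊞ y ≡ y ⊞ x
⊞-comm (zero  , c) (zero  , d) = cong (zero ,_) (ℤ.+-comm c d)
⊞-comm (zero  , _) (suc _ , _) = refl
⊞-comm (suc _ , _) (zero  , _) = refl
⊞-comm (suc m , c) (suc n , d) = cong raise (⊞-comm (m , c) (n , d))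

⊞-< : ∀ x y → proj₁ x < proj₁ y → x ⊞ y ≡ y
⊞-< (zero  , _) (suc _ , _) _         = refl
⊞-< (suc m , c) (suc n , d) (s≤s m<n) = cong raise (⊞-< (m , c) (n , d) m<n)

⊞-> : ∀ x y → proj₁ y < proj₁ x → x ⊞ y ≡ x
⊞-> x y y<x = trans (⊞-comm x y) (⊞-< y x y<x)

shape-mulT : ∀ p → shape (mulT p) ≡ raise (shape p)
shape-mulT p = cong (suc (length p) ,_) (lc-mulT p)

shape-∷ : ∀ x {p} → PosLead p → shape (x ∷ p) ≡ raise (shape p)
shape-∷ x {p} pl = cong (suc (length p) ,_) (lc-∷ x pl)

PosLead-⊕ : ∀ {p q} → PosLead p → PosLead q → PosLead (p ⊕ q) × shape (p ⊕ q) ≡ shape p ⊞ shape q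
PosLead-⊕ (lead m) (lead n) = lead (m + suc n) , refl
PosLead-⊕ {p} {y ∷ q} (lead m) (y ∷ ql) = (ℤ.+ suc m ℤ.+ y) ∷ ql , (begin
  shape (_ ∷ q)              ≡⟨ shape-∷ _ ql ⟩
  raise (shape q)            ≡⟨ cong raise (⊞-< (zero , ℤ.+ suc m) (shape q) (PosLead⇒0<length ql)) ⟨
  shape p ⊞ raise (shape q)  ≡⟨ cong (shape p ⊞_) (shape-∷ y ql) ⟨
  shape p ⊞ shape (y ∷ q)    ∎)
  where open ≡-Reasoning
PosLead-⊕ {x ∷ p} {q} (x ∷ pl) (lead n) rewrite ⊕-identityʳ p = (x ℤ.+ ℤ.+ suc n) ∷ pl , (begin
  shape (_ ∷ p)              ≡⟨ shape-∷ _ pl ⟩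
  raise (shape p)            ≡⟨ cong raise (⊞-> (shape p) (zero , ℤ.+ suc n) (PosLead⇒0<length pl)) ⟨
  raise (shape p) ⊞ shape q  ≡⟨ cong (_⊞ shape q) (shape-∷ x pl) ⟨
  shape (x ∷ p) ⊞ shape q    ∎)
  where open ≡-Reasoning
PosLead-⊕ {x ∷ p} {y ∷ q} (x ∷ pl) (y ∷ ql) with PosLead-⊕ pl ql
... | pql , shape≡ = (x ℤ.+ y) ∷ pql , (begin
  shape (_ ∷ (p ⊕ q))                ≡⟨ shape-∷ _ pql ⟩
  raise (shape (p ⊕ q))              ≡⟨ cong raise shape≡ ⟩
  raise (shape p) ⊞ raise (shape q)  ≡⟨ cong₂ _⊞_ (shape-∷ x pl) (shape-∷ y ql) ⟨
  shape (x ∷ p) ⊞ shape (y ∷ q)      ∎)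
  where open ≡-Reasoning

sternF-even : ∀ f n → 2 ≤ n → n % 2 ≡ 0 → sternF (suc f) n ≡ mulT (sternF f (n / 2))
sternF-even f (suc zero) (s≤s ()) _
sternF-even f (suc (suc m)) _ n%2≡0 with suc (suc m) % 2
... | zero = refl
sternF-even f (suc (suc m)) _ () | suc _

sternF-odd : ∀ f n → 2 ≤ n → n % 2 ≡ 1 → sternF (suc f) n ≡ sternF f (n / 2) ⊕ sternF f (suc (n / 2))
sternF-odd f (suc zero) (s≤s ()) _
sternF-odd f (suc (suc m)) _ n%2≡1 with suc (suc m) % 2
... | suc _ = refl
sternF-odd f (suc (suc m)) _ () | zero

sternF-2* : ∀ f k → 1 ≤ k → sternF (suc f) (2 * k) ≡ mulT (sternF f k)
sternF-2* f k 1≤k = trans (sternF-even f (2 * k) (*-monoʳ-≤ 2 1≤k) (2*n%2≡0 k))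
                          (cong (mulT ∘ sternF f) (2*n/2≡n k))

sternF-1+2* : ∀ f k → 1 ≤ k → sternF (suc f) (suc (2 * k)) ≡ sternF f k ⊕ sternF f (suc k)
sternF-1+2* f k 1≤k = trans (sternF-odd f (suc (2 * k)) (s≤s (≤-trans 1≤k (m≤m+n k _))) (1+2*n%2≡1 k))
                            (cong (λ h → sternF f h ⊕ sternF f (suc h)) (1+2*n/2≡n k))

sternF-stable : ∀ {f g} n → n < f → n < g → sternF f n ≡ sternF g n
sternF-stable {suc f} {suc g} n n<f n<g with parity n
... | even zero = refl
... | odd zero = refl
... | even k@(suc _) = begin
  sternF (suc f) (2 * k) ≡⟨ sternF-2* f k (s≤s z≤n) ⟩
  mulT (sternF f k)      ≡⟨ cong mulT (sternF-stable k (half< n<f) (half< n<g)) ⟩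
  mulT (sternF g k)      ≡⟨ sternF-2* g k (s≤s z≤n) ⟨
  sternF (suc g) (2 * k) ∎
  where
  open ≡-Reasoning
  half< : ∀ {h} → 2 * k < suc h → k < h
  half< 2k<1+h = <-≤-trans (n<2*n (s≤s z≤n)) (≤-pred 2k<1+h)
... | odd k@(suc _) = begin
  sternF (suc f) (suc (2 * k))         ≡⟨ sternF-1+2* f k (s≤s z≤n) ⟩
  sternF f k ⊕ sternF f (suc k)        ≡⟨ cong₂ _⊕_ (sternF-stable k (<-trans (n<1+n k) (half< n<f)) (<-trans (n<1+n k) (half< n<g)))
                                                     (sternF-stable (suc k) (half< n<f) (half< n<g)) ⟩
  sternF g k ⊕ sternF g (suc k)        ≡⟨ sternF-1+2* g k (s≤s z≤n) ⟨
  sternF (suc g) (suc (2 * k))         ∎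
  where
  open ≡-Reasoning
  half< : ∀ {h} → suc (2 * k) < suc h → suc k < h
  half< 2k+1<1+h = <-≤-trans (s≤s (n<2*n (s≤s z≤n))) (≤-pred 2k+1<1+h)

sternF-PosLead : ∀ f n → n < f → 1 ≤ n → PosLead (sternF f n)
sternF-PosLead (suc f) n n<f 1≤n with parity n
sternF-PosLead (suc f) .0 n<f () | even zero
... | odd zero = lead 0
... | even k@(suc _) = subst PosLead (sym (sternF-2* f k (s≤s z≤n)))
  (ℤ.+ 0 ∷ sternF-PosLead f k (<-≤-trans (n<2*n (s≤s z≤n)) (≤-pred n<f)) (s≤s z≤n))
... | odd k@(suc _) = subst PosLead (sym (sternF-1+2* f k (s≤s z≤n)))
  (proj₁ (PosLead-⊕ (sternF-PosLead f k (<-trans (n<1+n k) 1+k<f) (s≤s z≤n)) (sternF-PosLead f (suc k) 1+k<f (s≤s z≤n))))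
  where
  1+k<f : suc k < f
  1+k<f = <-≤-trans (s≤s (n<2*n (s≤s z≤n))) (≤-pred n<f)

B-2* : ∀ k → 1 ≤ k → B (2 * k) ≡ mulT (B k)
B-2* k 1≤k = trans (sternF-2* (2 * k) k 1≤k) (cong mulT (sternF-stable k (n<2*n 1≤k) (n<1+n k)))

B-1+2* : ∀ k → B (suc (2 * k)) ≡ B k ⊕ B (suc k)
B-1+2* zero = refl
B-1+2* k@(suc _) = trans (sternF-1+2* (suc (2 * k)) k (s≤s z≤n))
  (cong₂ _⊕_ (sternF-stable k (<-trans (n<1+n k) 1+k<1+2k) (n<1+n k))
             (sternF-stable (suc k) 1+k<1+2k (n<1+n (suc k))))
  where
  1+k<1+2k : suc k < suc (2 * k)
  1+k<1+2k = s≤s (n<2*n (s≤s z≤n))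

B-PosLead : ∀ n → 1 ≤ n → PosLead (B n)
B-PosLead n = sternF-PosLead (suc n) n (n<1+n n)

shapeB : ℕ → Shape
shapeB n = shape (B n)

shapeB-2* : ∀ k → 1 ≤ k → shapeB (2 * k) ≡ raise (shapeB k)
shapeB-2* k 1≤k = trans (cong shape (B-2* k 1≤k)) (shape-mulT (B k))

shapeB-1+2* : ∀ k → shapeB (suc (2 * k)) ≡ shapeB k ⊞ shapeB (suc k)
shapeB-1+2* zero = refl
shapeB-1+2* k@(suc _) = trans (cong shape (B-1+2* k))
  (proj₂ (PosLead-⊕ (B-PosLead k (s≤s z≤n)) (B-PosLead (suc k) (s≤s z≤n))))

length-B-2* : ∀ k → 1 ≤ k → length (B (2 * k)) ≡ suc (length (B k))
length-B-2* k 1≤k = cong length (B-2* k 1≤k)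

length-B-1+2* : ∀ k → length (B (suc (2 * k))) ≡ length (B k) ⊔ length (B (suc k))
length-B-1+2* k = trans (cong length (B-1+2* k)) (length-⊕ (B k) (B (suc k)))

length-B-rise⇒rise-at-4n+1 : ∀ n → 1 ≤ n → length (B (suc n)) ≡ suc (length (B n)) →
  length (B (suc (suc (2 * (2 * n))))) ≡ suc (length (B (suc (2 * (2 * n)))))
length-B-rise⇒rise-at-4n+1 n 1≤n jump = begin
  length (B (suc (suc (2 * (2 * n)))))  ≡⟨ cong (length ∘ B) (2*[1+n]≡2+2*n (2 * n)) ⟨
  length (B (2 * suc (2 * n)))          ≡⟨ length-B-2* (suc (2 * n)) (s≤s z≤n) ⟩
  suc (length (B (suc (2 * n))))        ≡⟨ cong suc ℓ[1+2n] ⟩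
  suc (suc L)                           ≡⟨ cong suc ℓ[1+4n] ⟨
  suc (length (B (suc (2 * (2 * n)))))  ∎
  where
  open ≡-Reasoning
  L = length (B n)
  ℓ[1+2n] : length (B (suc (2 * n))) ≡ suc L
  ℓ[1+2n] = trans (length-B-1+2* n) (trans (cong (L ⊔_) jump) (m≤n⇒m⊔n≡n (n≤1+n L)))
  ℓ[1+4n] : length (B (suc (2 * (2 * n)))) ≡ suc L
  ℓ[1+4n] = trans (length-B-1+2* (2 * n))
                  (trans (cong₂ _⊔_ (length-B-2* n 1≤n) ℓ[1+2n]) (⊔-idem (suc L)))

length-B-fall⇒fall-at-4n+2 : ∀ n → length (B n) ≡ suc (length (B (suc n))) →
  length (B (2 * suc (2 * n))) ≡ suc (length (B (suc (2 * suc (2 * n)))))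
length-B-fall⇒fall-at-4n+2 n jump = begin
  length (B (2 * suc (2 * n)))              ≡⟨ length-B-2* (suc (2 * n)) (s≤s z≤n) ⟩
  suc (length (B (suc (2 * n))))            ≡⟨ cong suc ℓ[1+2n] ⟩
  suc (suc L)                               ≡⟨ cong suc ℓ[1+2[1+2n]] ⟨
  suc (length (B (suc (2 * suc (2 * n)))))  ∎
  where
  open ≡-Reasoning
  L = length (B (suc n))
  ℓ[1+2n] : length (B (suc (2 * n))) ≡ suc L
  ℓ[1+2n] = trans (length-B-1+2* n) (trans (cong (_⊔ L) jump) (m≥n⇒m⊔n≡m (n≤1+n L)))
  ℓ[2+2n] : length (B (suc (suc (2 * n)))) ≡ suc L
  ℓ[2+2n] = trans (cong (length ∘ B) (sym (2*[1+n]≡2+2*n n))) (length-B-2* (suc n) (s≤s z≤n))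
  ℓ[1+2[1+2n]] : length (B (suc (2 * suc (2 * n)))) ≡ suc L
  ℓ[1+2[1+2n]] = trans (length-B-1+2* (suc (2 * n)))
                       (trans (cong₂ _⊔_ ℓ[1+2n] ℓ[2+2n]) (⊔-idem (suc L)))

a-pos : ∀ i → 1 ≤ a (suc i)
a-pos zero          = s≤s z≤n
a-pos (suc zero)    = s≤s z≤n
a-pos (suc (suc i)) = ≤-trans (a-pos i) (m≤n+m _ _)

a-mono : ∀ i → a (suc i) ≤ a (suc (suc i))
a-mono zero          = s≤s z≤n
a-mono (suc zero)    = s≤s (s≤s z≤n)
a-mono (suc (suc i)) = +-mono-≤ (^-monoʳ-≤ 2 (n≤1+n (suc i))) (a-mono i)

a-double-even : ∀ h → 2 * a (suc (2 * h)) ≡ a (suc (suc (2 * h)))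
a-double-even zero    = refl
a-double-even (suc h) = begin
  2 * a (suc (2 * suc h))                         ≡⟨ cong (λ j → 2 * a (suc j)) (2*[1+n]≡2+2*n h) ⟩
  2 * (2 ^ suc (2 * h) + a (suc (2 * h)))         ≡⟨ *-distribˡ-+ 2 (2 ^ suc (2 * h)) _ ⟩
  2 ^ suc (suc (2 * h)) + 2 * a (suc (2 * h))     ≡⟨ cong (2 ^ suc (suc (2 * h)) +_) (a-double-even h) ⟩
  2 ^ suc (suc (2 * h)) + a (suc (suc (2 * h)))   ≡⟨ cong (λ j → a (suc (suc j))) (2*[1+n]≡2+2*n h) ⟨
  a (suc (suc (2 * suc h)))                       ∎
  where open ≡-Reasoning

a-double-odd : ∀ h → 2 * a (suc (suc (2 * h))) ≡ suc (a (suc (suc (suc (2 * h)))))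
a-double-odd zero    = refl
a-double-odd (suc h) = begin
  2 * a (suc (suc (2 * suc h)))                               ≡⟨ cong (λ j → 2 * a (suc (suc j))) (2*[1+n]≡2+2*n h) ⟩
  2 * (2 ^ suc (suc (2 * h)) + a (suc (suc (2 * h))))         ≡⟨ *-distribˡ-+ 2 (2 ^ suc (suc (2 * h))) _ ⟩
  2 ^ suc (suc (suc (2 * h))) + 2 * a (suc (suc (2 * h)))     ≡⟨ cong (2 ^ suc (suc (suc (2 * h))) +_) (a-double-odd h) ⟩
  2 ^ suc (suc (suc (2 * h))) + suc (a (suc (suc (suc (2 * h))))) ≡⟨ +-suc _ _ ⟩
  suc (a (suc (suc (suc (suc (suc (2 * h)))))))               ≡⟨ cong (λ j → suc (a (suc (suc (suc j))))) (2*[1+n]≡2+2*n h) ⟨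
  suc (a (suc (suc (suc (2 * suc h)))))                       ∎
  where open ≡-Reasoning

a-double-≤ : ∀ i → 2 * a (suc i) ≤ suc (a (suc (suc i)))
a-double-≤ i with parity i
... | even h = ≤-trans (≤-reflexive (a-double-even h)) (n≤1+n _)
... | odd h  = ≤-reflexive (a-double-odd h)

a-double⊎odd : ∀ i → 2 * a (suc i) ≡ a (suc (suc i)) ⊎ ∃[ h ] i ≡ suc (2 * h)
a-double⊎odd i with parity i
... | even h = inj₁ (a-double-even h)
... | odd h  = inj₂ (h , refl)

a-≤-half : ∀ i {q} → a (suc (suc i)) ≤ 2 * q → a (suc i) ≤ q
a-≤-half i lo = half-≤ (≤-trans (a-double-≤ i) (s≤s lo))

a-≤-half-suc : ∀ i {q} → a (suc (suc i)) ≤ suc (2 * q) → a (suc i) ≤ suc q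
a-≤-half-suc i {q} lo = *-cancelˡ-≤ 2 (begin
  2 * a (suc i)          ≤⟨ a-double-≤ i ⟩
  suc (a (suc (suc i)))  ≤⟨ s≤s lo ⟩
  suc (suc (2 * q))      ≡⟨ 2*[1+n]≡2+2*n q ⟨
  2 * suc q              ∎)
  where open ≤-Reasoning

a-quadruple : ∀ h → 2 * (2 * a (suc (suc (2 * h)))) ≡ suc (suc (a (suc (suc (2 * suc h)))))
a-quadruple h = begin
  2 * (2 * a (suc (suc (2 * h))))               ≡⟨ cong (2 *_) (a-double-odd h) ⟩
  2 * suc (a (suc (suc (suc (2 * h)))))         ≡⟨ 2*[1+n]≡2+2*n _ ⟩
  suc (suc (2 * a (suc (suc (suc (2 * h))))))   ≡⟨ cong (λ j → suc (suc (2 * a (suc j)))) (2*[1+n]≡2+2*n h) ⟨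
  suc (suc (2 * a (suc (2 * suc h))))           ≡⟨ cong (suc ∘ suc) (a-double-even (suc h)) ⟩
  suc (suc (a (suc (suc (2 * suc h)))))         ∎
  where open ≡-Reasoning

-- a_{2h+2} − 1 = (4^{h+1} − 1)/3, binary 1010…1 (suc-beforeA)
beforeA : ℕ → ℕ
beforeA zero    = 1
beforeA (suc h) = suc (2 * (2 * beforeA h))

beforeA-pos : ∀ h → 1 ≤ beforeA h
beforeA-pos zero    = s≤s z≤n
beforeA-pos (suc _) = s≤s z≤n

suc-beforeA : ∀ h → suc (beforeA h) ≡ a (suc (suc (2 * h)))
suc-beforeA zero    = refl
suc-beforeA (suc h) = suc-injective (suc-injective (begin
  suc (suc (suc (suc (2 * (2 * beforeA h)))))  ≡⟨ 2*[2*[1+n]]≡4+2*[2*n] (beforeA h) ⟨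
  2 * (2 * suc (beforeA h))                    ≡⟨ cong (λ n → 2 * (2 * n)) (suc-beforeA h) ⟩
  2 * (2 * a (suc (suc (2 * h))))              ≡⟨ a-quadruple h ⟩
  suc (suc (a (suc (suc (2 * suc h)))))        ∎))
  where open ≡-Reasoning

length-B-rises-at-beforeA : ∀ h → length (B (suc (beforeA h))) ≡ suc (length (B (beforeA h)))
length-B-rises-at-beforeA zero    = refl
length-B-rises-at-beforeA (suc h) = length-B-rise⇒rise-at-4n+1 (beforeA h) (beforeA-pos h) (length-B-rises-at-beforeA h)

-- 3·2^{2h+1} − a_{2h+2} (mirrorA-+-a), which is 2^k − b_k for k = 2h + 3
mirrorA : ℕ → ℕ
mirrorA zero    = 4
mirrorA (suc h) = 2 * suc (2 * mirrorA h)

mirrorA-+-a : ∀ h → mirrorA h + a (suc (suc (2 * h))) ≡ 2 * 2 ^ suc (2 * h) + 2 ^ suc (2 * h)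
mirrorA-+-a zero    = refl
mirrorA-+-a (suc h) = begin
  2 * suc (2 * q) + a (suc (suc (2 * suc h)))     ≡⟨ regroup q _ ⟩
  2 * (2 * q) + suc (suc (a (suc (suc (2 * suc h)))))  ≡⟨ cong (2 * (2 * q) +_) (a-quadruple h) ⟨
  2 * (2 * q) + 2 * (2 * A)                       ≡⟨ factor q A ⟩
  2 * (2 * (q + A))                               ≡⟨ cong (λ n → 2 * (2 * n)) (mirrorA-+-a h) ⟩
  2 * (2 * (2 * T + T))                           ≡⟨ expand T ⟩
  2 * (2 * (2 * T)) + 2 * (2 * T)                 ≡⟨ cong (λ j → 2 * 2 ^ suc j + 2 ^ suc j) (2*[1+n]≡2+2*n h) ⟨
  2 * 2 ^ suc (2 * suc h) + 2 ^ suc (2 * suc h)   ∎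
  where
  open ≡-Reasoning
  q = mirrorA h
  A = a (suc (suc (2 * h)))
  T = 2 ^ suc (2 * h)
  regroup : ∀ q A′ → 2 * suc (2 * q) + A′ ≡ 2 * (2 * q) + suc (suc A′)
  regroup = solve-∀
  factor : ∀ q A → 2 * (2 * q) + 2 * (2 * A) ≡ 2 * (2 * (q + A))
  factor = solve-∀
  expand : ∀ T → 2 * (2 * (2 * T + T)) ≡ 2 * (2 * (2 * T)) + 2 * (2 * T)
  expand = solve-∀

length-B-falls-at-mirrorA : ∀ h → length (B (mirrorA h)) ≡ suc (length (B (suc (mirrorA h))))
length-B-falls-at-mirrorA zero    = refl
length-B-falls-at-mirrorA (suc h) = length-B-fall⇒fall-at-4n+2 (mirrorA h) (length-B-falls-at-mirrorA h)

length-B-rises-before-a : ∀ h {n} → suc n ≡ a (suc (suc (2 * h))) → length (B n) < length (B (suc n))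
length-B-rises-before-a h 1+n≡a =
  subst (λ n → length (B n) < length (B (suc n)))
        (suc-injective (trans (suc-beforeA h) (sym 1+n≡a)))
        (≤-reflexive (sym (length-B-rises-at-beforeA h)))

length-B-falls-at-mirror : ∀ h {n} → n + a (suc (suc (2 * h))) ≡ 2 * 2 ^ suc (2 * h) + 2 ^ suc (2 * h) →
  length (B (suc n)) < length (B n)
length-B-falls-at-mirror h {n} n+a≡3T =
  subst (λ n → length (B (suc n)) < length (B n))
        (+-cancelʳ-≡ _ (mirrorA h) n (trans (mirrorA-+-a h) (sym n+a≡3T)))
        (≤-reflexive (sym (length-B-falls-at-mirrorA h)))

shapeB-odd-split : ∀ n q → shapeB (2 * n + suc (2 * q)) ≡ shapeB (n + q) ⊞ shapeB (n + suc q)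
shapeB-odd-split n q = begin
  shapeB (2 * n + suc (2 * q))            ≡⟨ cong shapeB (2*m+[1+2*n]≡1+2*[m+n] n q) ⟩
  shapeB (suc (2 * (n + q)))              ≡⟨ shapeB-1+2* (n + q) ⟩
  shapeB (n + q) ⊞ shapeB (suc (n + q))   ≡⟨ cong (λ k → shapeB (n + q) ⊞ shapeB k) (+-suc n q) ⟨
  shapeB (n + q) ⊞ shapeB (n + suc q)     ∎
  where open ≡-Reasoning

shapeB-shift-boundary : ∀ h q → suc q ≡ a (suc (suc (2 * h))) →
  shapeB (2 ^ suc (suc (2 * h)) + suc q) ≡ raise (shapeB (suc q)) →
  shapeB (2 * 2 ^ suc (suc (2 * h)) + suc (2 * q)) ≡ raise (shapeB (suc (2 * q)))
shapeB-shift-boundary h q 1+q≡a shift = begin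
  shapeB (2 * T + suc (2 * q))            ≡⟨ shapeB-odd-split T q ⟩
  shapeB (T + q) ⊞ shapeB (T + suc q)     ≡⟨ ⊞-< (shapeB (T + q)) _ rises-at-T+q ⟩
  shapeB (T + suc q)                      ≡⟨ shift ⟩
  raise (shapeB (suc q))                  ≡⟨ cong raise (⊞-< (shapeB q) _ (length-B-rises-before-a h 1+q≡a)) ⟨
  raise (shapeB q ⊞ shapeB (suc q))       ≡⟨ cong raise (shapeB-1+2* q) ⟨
  raise (shapeB (suc (2 * q)))            ∎
  where
  open ≡-Reasoning
  T = 2 ^ suc (suc (2 * h))
  1+T+q≡a : suc (T + q) ≡ a (suc (suc (2 * suc h)))
  1+T+q≡a = begin
    suc (T + q)                    ≡⟨ +-suc T q ⟨
    T + suc q                      ≡⟨ cong (T +_) 1+q≡a ⟩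
    a (suc (suc (suc (suc (2 * h)))))  ≡⟨ cong (λ j → a (suc (suc j))) (2*[1+n]≡2+2*n h) ⟨
    a (suc (suc (2 * suc h)))      ∎
  rises-at-T+q : length (B (T + q)) < length (B (T + suc q))
  rises-at-T+q = subst (λ k → length (B (T + q)) < length (B k)) (sym (+-suc T q))
                       (length-B-rises-before-a (suc h) 1+T+q≡a)

shapeB-shift : ∀ i m → a (suc i) ≤ m → m ≤ 2 ^ suc i → shapeB (2 ^ suc i + m) ≡ raise (shapeB m)
shapeB-shift zero zero                () _
shapeB-shift zero (suc zero)          _  _ = refl
shapeB-shift zero (suc (suc zero))    _  _ = refl
shapeB-shift zero (suc (suc (suc _))) _  (s≤s (s≤s ()))
shapeB-shift (suc i) m lo hi with parity m
... | even q = begin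
  shapeB (2 * T + 2 * q)    ≡⟨ cong shapeB (*-distribˡ-+ 2 T q) ⟨
  shapeB (2 * (T + q))      ≡⟨ shapeB-2* (T + q) (≤-trans 1≤q (m≤n+m q T)) ⟩
  raise (shapeB (T + q))    ≡⟨ cong raise (shapeB-shift i q q-lo (*-cancelˡ-≤ 2 hi)) ⟩
  raise (raise (shapeB q))  ≡⟨ cong raise (shapeB-2* q 1≤q) ⟨
  raise (shapeB (2 * q))    ∎
  where
  open ≡-Reasoning
  T = 2 ^ suc i
  q-lo : a (suc i) ≤ q
  q-lo = a-≤-half i lo
  1≤q : 1 ≤ q
  1≤q = ≤-trans (a-pos i) q-lo
... | odd q with a (suc i) ≤? q | a-double⊎odd i
...   | yes q-lo | _ = begin
  shapeB (2 * T + suc (2 * q))            ≡⟨ shapeB-odd-split T q ⟩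
  shapeB (T + q) ⊞ shapeB (T + suc q)     ≡⟨ cong₂ _⊞_ (shapeB-shift i q q-lo (<⇒≤ q<T))
                                                        (shapeB-shift i (suc q) (≤-trans q-lo (n≤1+n q)) q<T) ⟩
  raise (shapeB q ⊞ shapeB (suc q))       ≡⟨ cong raise (shapeB-1+2* q) ⟨
  raise (shapeB (suc (2 * q)))            ∎
  where
  open ≡-Reasoning
  T = 2 ^ suc i
  q<T : q < T
  q<T = *-cancelˡ-< 2 q T hi
...   | no q≱ | inj₁ 2a≡a′ = contradiction (half-≤ (subst (_≤ suc (2 * q)) (sym 2a≡a′) lo)) q≱
...   | no q≱ | inj₂ (h , refl) =
  shapeB-shift-boundary h q 1+q≡a (shapeB-shift i (suc q) (≤-reflexive (sym 1+q≡a)) (*-cancelˡ-< 2 q _ hi))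
  where
  1+q≡a : suc q ≡ a (suc i)
  1+q≡a = ≤-antisym (≰⇒> q≱) (a-≤-half-suc i lo)

shapeB-mirror-boundary : ∀ h s t → suc t ≡ a (suc (suc (2 * h))) → s + suc t ≡ 2 ^ suc (2 * h) →
  shapeB (2 * 2 ^ suc (2 * h) + s) ≡ raise (shapeB (suc t)) →
  shapeB (2 * (2 * 2 ^ suc (2 * h)) + suc (2 * s)) ≡ raise (shapeB (suc (2 * t)))
shapeB-mirror-boundary h s t 1+t≡a s+1+t≡T mirror = begin
  shapeB (2 * (2 * T) + suc (2 * s))           ≡⟨ shapeB-odd-split (2 * T) s ⟩
  shapeB (2 * T + s) ⊞ shapeB (2 * T + suc s)  ≡⟨ ⊞-> _ (shapeB (2 * T + suc s)) falls-at-2T+s ⟩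
  shapeB (2 * T + s)                           ≡⟨ mirror ⟩
  raise (shapeB (suc t))                       ≡⟨ cong raise (⊞-< (shapeB t) _ (length-B-rises-before-a h 1+t≡a)) ⟨
  raise (shapeB t ⊞ shapeB (suc t))            ≡⟨ cong raise (shapeB-1+2* t) ⟨
  raise (shapeB (suc (2 * t)))                 ∎
  where
  open ≡-Reasoning
  T = 2 ^ suc (2 * h)
  2T+s+a≡3T : (2 * T + s) + a (suc (suc (2 * h))) ≡ 2 * T + T
  2T+s+a≡3T = begin
    (2 * T + s) + a (suc (suc (2 * h)))  ≡⟨ cong ((2 * T + s) +_) 1+t≡a ⟨
    (2 * T + s) + suc t                  ≡⟨ +-assoc (2 * T) s (suc t) ⟩
    2 * T + (s + suc t)                  ≡⟨ cong (2 * T +_) s+1+t≡T ⟩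
    2 * T + T                            ∎
  falls-at-2T+s : length (B (2 * T + suc s)) < length (B (2 * T + s))
  falls-at-2T+s = subst (λ k → length (B k) < length (B (2 * T + s))) (sym (+-suc (2 * T) s))
                        (length-B-falls-at-mirror h 2T+s+a≡3T)

shapeB-mirror : ∀ i r m → r + m ≡ 2 ^ suc i → a (suc (suc i)) ≤ m →
  shapeB (2 ^ suc (suc i) + r) ≡ raise (shapeB m)
shapeB-mirror zero zero    _ refl _   = refl
shapeB-mirror zero (suc r) m r+m≡2 2≤m =
  contradiction (≤-trans 2≤m (≤-trans (m≤n+m m r) (≤-reflexive (suc-injective r+m≡2)))) 1+n≰n
shapeB-mirror (suc i) r m r+m≡2T lo with parity r | parity m
... | even s | even t = begin
  shapeB (2 * (2 * T) + 2 * s)  ≡⟨ cong shapeB (*-distribˡ-+ 2 (2 * T) s) ⟨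
  shapeB (2 * (2 * T + s))      ≡⟨ shapeB-2* (2 * T + s) (≤-trans (m^n>0 2 (suc (suc i))) (m≤m+n _ s)) ⟩
  raise (shapeB (2 * T + s))    ≡⟨ cong raise (shapeB-mirror i s t s+t≡T t-lo) ⟩
  raise (raise (shapeB t))      ≡⟨ cong raise (shapeB-2* t (≤-trans (a-pos (suc i)) t-lo)) ⟨
  raise (shapeB (2 * t))        ∎
  where
  open ≡-Reasoning
  T = 2 ^ suc i
  s+t≡T : s + t ≡ T
  s+t≡T = *-cancelˡ-≡ (s + t) T 2 (trans (*-distribˡ-+ 2 s t) r+m≡2T)
  t-lo : a (suc (suc i)) ≤ t
  t-lo = a-≤-half (suc i) lo
... | even s | odd t = contradiction (trans (sym r+m≡2T) (2*m+[1+2*n]≡1+2*[m+n] s t)) (even≢odd (2 ^ suc i) (s + t))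
... | odd s | even t = contradiction (trans (sym r+m≡2T) (cong suc (sym (*-distribˡ-+ 2 s t)))) (even≢odd (2 ^ suc i) (s + t))
... | odd s | odd t with a (suc (suc i)) ≤? t | a-double⊎odd (suc i)
...   | yes t-lo | _ = begin
  shapeB (2 * (2 * T) + suc (2 * s))           ≡⟨ shapeB-odd-split (2 * T) s ⟩
  shapeB (2 * T + s) ⊞ shapeB (2 * T + suc s)  ≡⟨ cong₂ _⊞_ (shapeB-mirror i s (suc t) (odd+odd≡2*⇒ r+m≡2T) (a-≤-half-suc (suc i) lo))
                                                            (shapeB-mirror i (suc s) t (trans (sym (+-suc s t)) (odd+odd≡2*⇒ r+m≡2T)) t-lo) ⟩
  raise (shapeB (suc t) ⊞ shapeB t)            ≡⟨ cong raise (⊞-comm (shapeB (suc t)) (shapeB t)) ⟩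
  raise (shapeB t ⊞ shapeB (suc t))            ≡⟨ cong raise (shapeB-1+2* t) ⟨
  raise (shapeB (suc (2 * t)))                 ∎
  where
  open ≡-Reasoning
  T = 2 ^ suc i
...   | no t≱ | inj₁ 2a≡a′ = contradiction (half-≤ (subst (_≤ suc (2 * t)) (sym 2a≡a′) lo)) t≱
...   | no t≱ | inj₂ (h , refl) =
  shapeB-mirror-boundary h s t 1+t≡a (odd+odd≡2*⇒ r+m≡2T)
    (shapeB-mirror i s (suc t) (odd+odd≡2*⇒ r+m≡2T) (≤-reflexive (sym 1+t≡a)))
  where
  1+t≡a : suc t ≡ a (suc (suc i))
  1+t≡a = ≤-antisym (≰⇒> t≱) (a-≤-half-suc (suc i) lo)

cardI-+-cardI : ∀ n → cardI (suc n) + cardI (suc (suc n)) ≡ 2 ^ suc n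
cardI-+-cardI zero    = refl
cardI-+-cardI (suc n) = trans (regroup (cardI (suc n)) (cardI (suc (suc n)))) (cong (2 *_) (cardI-+-cardI n))
  where
  regroup : ∀ x y → y + (2 * x + y) ≡ 2 * (x + y)
  regroup = solve-∀

a-+-cardI : ∀ n → a (suc n) + cardI (suc n) ≡ a (suc (suc n))
a-+-cardI zero       = refl
a-+-cardI (suc zero) = refl
a-+-cardI (suc (suc n)) = begin
  (2 ^ suc n + x) + (2 * c + d)    ≡⟨ cong (λ y → (y + x) + (2 * c + d)) (cardI-+-cardI n) ⟨
  ((c + d) + x) + (2 * c + d)      ≡⟨ regroup c d x ⟩
  2 * (c + d) + (x + c)            ≡⟨ cong₂ (λ y z → 2 * y + z) (cardI-+-cardI n) (a-+-cardI n) ⟩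
  2 ^ suc (suc n) + a (suc (suc n)) ∎
  where
  open ≡-Reasoning
  x = a (suc n)
  c = cardI (suc n)
  d = cardI (suc (suc n))
  regroup : ∀ c d x → ((c + d) + x) + (2 * c + d) ≡ 2 * (c + d) + (x + c)
  regroup = solve-∀

b≡2^+a : ∀ i → b (suc (suc (suc i))) ≡ 2 ^ suc i + a (suc (suc i))
b≡2^+a i = trans (+-assoc (2 ^ suc i) (a (suc i)) _) (cong (2 ^ suc i +_) (a-+-cardI i))

∸-reflect : ∀ r m → 2 * (2 * (r + m)) ∸ ((r + m) + m) ≡ 2 * (r + m) + r
∸-reflect r m = trans (cong (_∸ ((r + m) + m)) (regroup r m)) (m+n∸n≡m (2 * (r + m) + r) ((r + m) + m))
  where
  regroup : ∀ r m → 2 * (2 * (r + m)) ≡ (2 * (r + m) + r) + ((r + m) + m)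
  regroup = solve-∀

mainTheorem13 : (k u : ℕ) → 3 ≤ k → b k + u ≤ 2 ^ (k ∸ 1) →
    (lc (B (b k + u)) ≡ lc (B (a (k ∸ 1) + u)))
    × (lc (B (2 ^ k ∸ (b k + u))) ≡ lc (B (a (k ∸ 1) + u)))
mainTheorem13 (suc zero)          _ (s≤s ()) _
mainTheorem13 (suc (suc zero))    _ (s≤s (s≤s ())) _
mainTheorem13 (suc (suc (suc i))) u _ b+u≤2T =
    trans (cong (lc ∘ B) b+u≡T+m) (cong proj₂ (shapeB-shift i m (≤-trans (a-mono i) (m≤m+n _ u)) m≤T))
  , trans (cong (lc ∘ B) reflect≡) (cong proj₂ (shapeB-mirror i (T ∸ m) m (m∸n+n≡m m≤T) (m≤m+n _ u)))
  where
  T = 2 ^ suc i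
  m = a (suc (suc i)) + u
  b+u≡T+m : b (suc (suc (suc i))) + u ≡ T + m
  b+u≡T+m = trans (cong (_+ u) (b≡2^+a i)) (+-assoc T _ u)
  m≤T : m ≤ T
  m≤T = ≤-trans (+-cancelˡ-≤ T m _ (subst (_≤ 2 * T) b+u≡T+m b+u≤2T)) (≤-reflexive (+-identityʳ T))
  reflect≡ : 2 * (2 * T) ∸ (b (suc (suc (suc i))) + u) ≡ 2 * T + (T ∸ m)
  reflect≡ = trans (cong (2 * (2 * T) ∸_) b+u≡T+m)
                   (subst (λ n → 2 * (2 * n) ∸ (n + m) ≡ 2 * n + (T ∸ m)) (m∸n+n≡m m≤T) (∸-reflect (T ∸ m) m))
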